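{- Let $G$ be a connected graph. Then: (i) $\mu_t(G) = {\rm n}(G)$ if and only if $G$ is a complete graph; (ii) $\mu_t(G) = {\rm n}(G)-1$ if and only if $G$ is a non-complete graph with $\gamma(G)=1$.
   Context: All graphs are finite, simple and undirected. ${\rm n}(G)$ is the order and $\gamma(G)$ the domination number of $G$. For $X\subseteq V(G)$, two vertices $x,y\in V(G)$ are $X$-visible if there is a shortest $x,y$-path in $G$ none of whose internal vertices lies in $X$. $X$ is a total mutual-visibility set of $G$ if every two vertices of $G$ are $X$-visible; $\mu_t(G)$ is the maximum cardinality of such a set. -}

module Defs where

open import Data.Nat using (ℕ; zero; suc; _≤_; _<_)
open import Data.Fin using (Fin; zero; suc; toℕ; fromℕ; inject₁)
open import Data.Fin.Subset using (Subset; _∈_; _∉_; ∣_∣)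
open import Data.Bool using (Bool; true; false)
open import Data.Product using (Σ; ∃; _×_; _,_)
open import Data.Sum using (_⊎_)
open import Relation.Binary.PropositionalEquality using (_≡_; _≢_)
open import Relation.Nullary using (¬_)

record Graph (n : ℕ) : Set where
  field
    adj    : Fin n → Fin n → Bool
    sym    : ∀ x y → adj x y ≡ adj y x
    irrefl : ∀ x → adj x x ≡ false
open Graph public

module _ {n : ℕ} (G : Graph n) where

  record Walk (x y : Fin n) (k : ℕ) : Set where
    field
      vert  : Fin (suc k) → Fin n
      start : vert zero ≡ x
      end   : vert (fromℕ k) ≡ y
      step  : ∀ (i : Fin k) → adj G (vert (inject₁ i)) (vert (suc i)) ≡ true
  open Walk public

  IsShortest : ∀ {x y k} → Walk x y k → Set
  IsShortest {x} {y} {k} _ = ∀ j → j < k → ¬ Walk x y j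

  Connected : Set
  Connected = ∀ x y → ∃ λ k → Walk x y k

  Complete : Set
  Complete = ∀ x y → x ≢ y → adj G x y ≡ true

  Visible : Subset n → Fin n → Fin n → Set
  Visible X x y = Σ ℕ λ k → Σ (Walk x y k) λ w → IsShortest w ×
    (∀ (i : Fin (suc k)) → 0 < toℕ i → toℕ i < k → vert w i ∉ X)

  IsTotalMutualVisibilitySet : Subset n → Set
  IsTotalMutualVisibilitySet X = ∀ x y → Visible X x y

  IsMuT : ℕ → Set
  IsMuT m = (∃ λ X → IsTotalMutualVisibilitySet X × ∣ X ∣ ≡ m)
          × (∀ X → IsTotalMutualVisibilitySet X → ∣ X ∣ ≤ m)

  IsDominating : Subset n → Set
  IsDominating D = ∀ v → v ∈ D ⊎ (∃ λ u → u ∈ D × adj G u v ≡ true)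

  IsGamma : ℕ → Set
  IsGamma g = (∃ λ D → IsDominating D × ∣ D ∣ ≡ g)
            × (∀ D → IsDominating D → g ≤ ∣ D ∣)

-- Visibility can only fail for two non-adjacent vertices, and a shortest path between them
-- has length at least two, so its first internal vertex is a neighbour of the start that must
-- lie outside X. Hence V(G) is a total mutual-visibility set exactly when G is complete, and a
-- set missing a single vertex u is one exactly when u is adjacent to every other vertex, which
-- is exactly γ(G) = 1; counting then pins down μ_t(G) ∈ {n(G), n(G) - 1}.
module Submission where

open import Defs
open import Data.Nat using (ℕ; suc; zero; _∸_; _≤_; _<_; z≤n; s≤s; s≤s⁻¹)
open import Data.Nat.Properties using (≤-antisym; ≤-trans; ≤∧≢⇒<; m+n∸n≡m; 1+n≢n; n≮n)
open import Data.Fin using (Fin; zero; suc; toℕ; _≟_)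
open import Data.Fin.Subset using (Subset; _∈_; _∉_; ∣_∣; ⊤; ⊥; ⁅_⁆; ∁; _-_; Nonempty)
open import Data.Fin.Subset.Properties
  using (x∈p⇒∣p-x∣<∣p∣; x∈p∧x≢y⇒x∈p-y; nonempty?; Empty-unique; ∣⊥∣≡0; ∈⊤; ∣⊤∣≡n;
         ∣p∣≡n⇒p≡⊤; ∣p∣≤n; ∣∁p∣≡n∸∣p∣; ∣⁅x⁆∣≡1; x∈⁅x⁆; x∈p⇒x∉∁p; x∉p⇒x∈∁p)
open import Data.Bool using (true; false)
open import Data.Product using (_×_; _,_; ∃)
open import Data.Sum using (inj₁; inj₂)
open import Data.Empty using (⊥-elim)
open import Function.Bundles using (_⇔_; mk⇔; Equivalence)
open import Relation.Binary.PropositionalEquality as ≡ using (_≡_; _≢_; refl; trans; subst; subst₂; cong)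
open import Relation.Nullary using (¬_; yes; no; contradiction)

module _ {n : ℕ} where

  x∈p⇒0<∣p∣ : ∀ {p : Subset n} {x} → x ∈ p → 0 < ∣ p ∣
  x∈p⇒0<∣p∣ x∈p = ≤-trans (s≤s z≤n) (x∈p⇒∣p-x∣<∣p∣ x∈p)

  0<∣p∣⇒Nonempty : ∀ {p : Subset n} → 0 < ∣ p ∣ → Nonempty p
  0<∣p∣⇒Nonempty {p} 0<∣p∣ with nonempty? p
  ... | yes nonempty = nonempty
  ... | no p-empty = ⊥-elim (n≮n 0 (subst (0 <_) (∣⊥∣≡0 n) 0<∣⊥∣))
    where
      0<∣⊥∣ : 0 < ∣ ⊥ {n = n} ∣
      0<∣⊥∣ = subst (λ q → 0 < ∣ q ∣) (Empty-unique p-empty) 0<∣p∣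

  ∣p∣≡1⇒singleton : ∀ {p : Subset n} → ∣ p ∣ ≡ 1 → ∃ λ x → x ∈ p × (∀ y → y ∈ p → y ≡ x)
  ∣p∣≡1⇒singleton {p} ∣p∣≡1 with 0<∣p∣⇒Nonempty {p} (subst (0 <_) (≡.sym ∣p∣≡1) (s≤s z≤n))
  ... | x , x∈p = x , x∈p , unique
    where
      unique : ∀ y → y ∈ p → y ≡ x
      unique y y∈p with y ≟ x
      ... | yes y≡x = y≡x
      ... | no y≢x with subst (suc ∣ p - x ∣ ≤_) ∣p∣≡1 (x∈p⇒∣p-x∣<∣p∣ x∈p)
      ...   | s≤s ∣p-x∣≤0 with ≤-trans (x∈p⇒0<∣p∣ (x∈p∧x≢y⇒x∈p-y y∈p y≢x)) ∣p-x∣≤0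
      ...     | ()

  ∣p∣≡n⇒∣∁p∣≡1 : ∀ (p : Subset (suc n)) → ∣ p ∣ ≡ n → ∣ ∁ p ∣ ≡ 1
  ∣p∣≡n⇒∣∁p∣≡1 p ∣p∣≡n = trans (∣∁p∣≡n∸∣p∣ p) (trans (cong (suc n ∸_) ∣p∣≡n) (m+n∸n≡m 1 n))

  ∣∁⁅x⁆∣≡n : ∀ (x : Fin (suc n)) → ∣ ∁ ⁅ x ⁆ ∣ ≡ n
  ∣∁⁅x⁆∣≡n x = trans (∣∁p∣≡n∸∣p∣ ⁅ x ⁆) (cong (suc n ∸_) (∣⁅x⁆∣≡1 x))

module _ {n : ℕ} (G : Graph n) where

  IsUniversal : Fin n → Set
  IsUniversal u = ∀ v → v ≢ u → adj G u v ≡ true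

  walk₀⇒≡ : ∀ {x y} → Walk G x y 0 → x ≡ y
  walk₀⇒≡ w = trans (≡.sym (start w)) (end w)

  walk₁⇒adj : ∀ {x y} → Walk G x y 1 → adj G x y ≡ true
  walk₁⇒adj w = subst₂ (λ a b → adj G a b ≡ true) (start w) (end w) (step w zero)

  walk-refl : ∀ x → Walk G x x 0
  walk-refl x = record { vert = λ _ → x ; start = refl ; end = refl ; step = λ () }

  walk-edge : ∀ {x y} → adj G x y ≡ true → Walk G x y 1
  walk-edge {x} {y} xy = record
    { vert = λ { zero → x ; (suc zero) → y }
    ; start = refl ; end = refl
    ; step = λ { zero → xy } }

  walk-via : ∀ {x a y} → adj G x a ≡ true → adj G a y ≡ true → Walk G x y 2
  walk-via {x} {a} {y} xa ay = record
    { vert = λ { zero → x ; (suc zero) → a ; (suc (suc zero)) → y }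
    ; start = refl ; end = refl
    ; step = λ { zero → xa ; (suc zero) → ay } }

  visible-refl : ∀ X x → Visible G X x x
  visible-refl X x = 0 , walk-refl x , (λ _ ()) , λ _ _ ()

  visible-adj : ∀ X {x y} → x ≢ y → adj G x y ≡ true → Visible G X x y
  visible-adj X x≢y xy = 1 , walk-edge xy , shortest , λ { zero () ; (suc zero) _ (s≤s ()) }
    where
      shortest : ∀ j → j < 1 → ¬ Walk G _ _ j
      shortest zero _ w = x≢y (walk₀⇒≡ w)
      shortest (suc _) (s≤s ())

  visible-via : ∀ X {x a y} → x ≢ y → adj G x y ≡ false →
                adj G x a ≡ true → adj G a y ≡ true → a ∉ X → Visible G X x y
  visible-via X x≢y ¬xy xa ay a∉X = 2 , walk-via xa ay , shortest , internal
    where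
      shortest : ∀ j → j < 2 → ¬ Walk G _ _ j
      shortest zero       _ w = x≢y (walk₀⇒≡ w)
      shortest (suc zero) _ w = contradiction (trans (≡.sym ¬xy) (walk₁⇒adj w)) λ ()
      shortest (suc (suc _)) (s≤s (s≤s ()))
      internal : ∀ i → 0 < toℕ i → toℕ i < 2 → _ ∉ X
      internal (suc zero) _ _ = a∉X
      internal (suc (suc zero)) _ (s≤s (s≤s ()))

  visible⇒neighbour∉ : ∀ X {x y} → Visible G X x y → x ≢ y → adj G x y ≡ false →
                       ∃ λ w → w ∉ X × adj G x w ≡ true
  visible⇒neighbour∉ X (zero , w , _) x≢y _ = ⊥-elim (x≢y (walk₀⇒≡ w))
  visible⇒neighbour∉ X (suc zero , w , _) _ ¬xy =
    contradiction (trans (≡.sym ¬xy) (walk₁⇒adj w)) λ ()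
  visible⇒neighbour∉ X (suc (suc _) , w , _ , internal) _ _ =
    vert w (suc zero) , internal (suc zero) (s≤s z≤n) (s≤s (s≤s z≤n)) ,
    subst (λ a → adj G a (vert w (suc zero)) ≡ true) (start w) (step w zero)

  complete⇒tmv : Complete G → ∀ X → IsTotalMutualVisibilitySet G X
  complete⇒tmv complete X x y with x ≟ y
  ... | yes refl = visible-refl X x
  ... | no x≢y   = visible-adj X x≢y (complete x y x≢y)

  tmv-⊤⇒complete : IsTotalMutualVisibilitySet G ⊤ → Complete G
  tmv-⊤⇒complete tmv x y x≢y with adj G x y in xy
  ... | true  = refl
  ... | false with visible⇒neighbour∉ ⊤ (tmv x y) x≢y xy
  ...   | _ , w∉⊤ , _ = ⊥-elim (w∉⊤ ∈⊤)

  tmv-outsider⇒universal : ∀ {X u} → IsTotalMutualVisibilitySet G X →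
                           (∀ w → w ∉ X → w ≡ u) → IsUniversal u
  tmv-outsider⇒universal {X} {u} tmv outsider v v≢u = trans (sym G u v) vu
    where
      vu : adj G v u ≡ true
      vu with adj G v u in ¬vu
      ... | true  = refl
      ... | false with visible⇒neighbour∉ X (tmv v u) v≢u ¬vu
      ...   | w , w∉X , vw = trans (≡.sym ¬vu) (subst (λ a → adj G v a ≡ true) (outsider w w∉X) vw)

  universal⇒tmv-∁⁅u⁆ : ∀ {u} → IsUniversal u → IsTotalMutualVisibilitySet G (∁ ⁅ u ⁆)
  universal⇒tmv-∁⁅u⁆ {u} universal x y with x ≟ y
  ... | yes refl = visible-refl _ x
  ... | no x≢y with adj G x y in xy
  ...   | true  = visible-adj _ x≢y xy
  ...   | false = visible-via _ x≢y xy
                    (trans (sym G x u) (universal x x≢u)) (universal y y≢u) (x∈p⇒x∉∁p (x∈⁅x⁆ u))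
    where
      x≢u : x ≢ u
      x≢u refl = contradiction (trans (≡.sym xy) (universal y (λ y≡x → x≢y (≡.sym y≡x)))) λ ()
      y≢u : y ≢ u
      y≢u refl = contradiction (trans (≡.sym xy) (trans (sym G x y) (universal x x≢y))) λ ()

  γ≡1⇔universal : IsGamma G 1 ⇔ ∃ IsUniversal
  γ≡1⇔universal = mk⇔ γ≡1⇒universal universal⇒γ≡1
    where
      γ≡1⇒universal : IsGamma G 1 → ∃ IsUniversal
      γ≡1⇒universal ((D , dominating , ∣D∣≡1) , _) with ∣p∣≡1⇒singleton ∣D∣≡1
      ... | u , _ , only-u = u , universal
        where
          universal : IsUniversal u
          universal v v≢u with dominating v
          ... | inj₁ v∈D            = ⊥-elim (v≢u (only-u v v∈D))
          ... | inj₂ (w , w∈D , wv) = subst (λ a → adj G a v ≡ true) (only-u w w∈D) wv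

      universal⇒γ≡1 : ∃ IsUniversal → IsGamma G 1
      universal⇒γ≡1 (u , universal) = (⁅ u ⁆ , dominating , ∣⁅x⁆∣≡1 u) , nonempty
        where
          dominating : IsDominating G ⁅ u ⁆
          dominating v with v ≟ u
          ... | yes refl = inj₁ (x∈⁅x⁆ u)
          ... | no v≢u   = inj₂ (u , x∈⁅x⁆ u , universal v v≢u)
          nonempty : ∀ D → IsDominating G D → 1 ≤ ∣ D ∣
          nonempty D dominating with dominating u
          ... | inj₁ u∈D           = x∈p⇒0<∣p∣ u∈D
          ... | inj₂ (_ , w∈D , _) = x∈p⇒0<∣p∣ w∈D

corollary2p3 : ∀ (n : ℕ) (G : Graph (suc n)) → Connected G →
    ∀ (m : ℕ) → IsMuT G m →
      ((m ≡ suc n) ⇔ Complete G) × ((m ≡ n) ⇔ (¬ Complete G × IsGamma G 1))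
corollary2p3 n G _ m ((X , X-tmv , ∣X∣≡m) , maximum) =
  mk⇔ m≡1+n⇒complete complete⇒m≡1+n , mk⇔ m≡n⇒γ≡1 γ≡1⇒m≡n
  where
    m≤1+n : m ≤ suc n
    m≤1+n = subst (_≤ suc n) ∣X∣≡m (∣p∣≤n X)

    m≡1+n⇒complete : m ≡ suc n → Complete G
    m≡1+n⇒complete m≡1+n =
      tmv-⊤⇒complete G (subst (IsTotalMutualVisibilitySet G) (∣p∣≡n⇒p≡⊤ (trans ∣X∣≡m m≡1+n)) X-tmv)

    complete⇒m≡1+n : Complete G → m ≡ suc n
    complete⇒m≡1+n complete =
      ≤-antisym m≤1+n (subst (_≤ m) (∣⊤∣≡n (suc n)) (maximum ⊤ (complete⇒tmv G complete ⊤)))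

    m≡n⇒γ≡1 : m ≡ n → ¬ Complete G × IsGamma G 1
    m≡n⇒γ≡1 m≡n with ∣p∣≡1⇒singleton (∣p∣≡n⇒∣∁p∣≡1 X (trans ∣X∣≡m m≡n))
    ... | u , _ , only-u =
      (λ complete → 1+n≢n (trans (≡.sym (complete⇒m≡1+n complete)) m≡n)) ,
      Equivalence.from (γ≡1⇔universal G)
        (u , tmv-outsider⇒universal G X-tmv (λ w w∉X → only-u w (x∉p⇒x∈∁p w∉X)))

    γ≡1⇒m≡n : ¬ Complete G × IsGamma G 1 → m ≡ n
    γ≡1⇒m≡n (incomplete , γ≡1) with Equivalence.to (γ≡1⇔universal G) γ≡1
    ... | u , universal =
      ≤-antisym (s≤s⁻¹ (≤∧≢⇒< m≤1+n (λ m≡1+n → incomplete (m≡1+n⇒complete m≡1+n))))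
                (subst (_≤ m) (∣∁⁅x⁆∣≡n u) (maximum _ (universal⇒tmv-∁⁅u⁆ G universal)))
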